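{- (1) If $(X,T,S)$ is a simple $\mathsf{MS^2IC}$-frame, then $(X,R_T,S)$ is a modal contact frame and $T=T_{R_T}$. (2) If $(X,R,S)$ is a modal contact frame, then $(X,T_R,S)$ is a simple $\mathsf{MS^2IC}$-frame and $R=R_{T_R}$. (3) The maps $(X,T,S)\mapsto(X,R_T,S)$ and $(X,R,S)\mapsto(X,T_R,S)$ give a one-to-one correspondence between simple $\mathsf{MS^2IC}$-frames and modal contact frames.
   Context: An $\mathsf{MS^2IC}$-frame can be taken to be a Kripke frame $(X,T,S)$ ($T$ ternary, $S$ binary on a set $X$) such that for all $x,y,z,w\in X$: $Txxx$; $Txyz$ implies $Txzy$; the relation $E_T$ given by $xE_Ty$ iff $\exists z\,Txyz$ is an equivalence relation; $Txyz$ and $xE_Tw$ imply $Twyz$; $Txyz$ and $ySw$ imply there is $u$ with $Txwu$ and $zSu$. It is simple if $X$ consists of a single $E_T$-equivalence class. A modal contact frame is $(X,R,S)$ with $X\neq\emptyset$, $R,S$ binary relations, $R$ reflexive and symmetric, and such that for all $x,y,z$, $xRy$ and $xSz$ imply there is $w$ with $zRw$ and $ySw$. For a simple $\mathsf{MS^2IC}$-frame define $xR_Ty$ iff $Txxy$; for a modal contact frame define $T_Rxyz$ iff $yRz$. -}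

module Defs where

open import Level using (Level; suc; _⊔_)
open import Data.Product using (Σ; ∃; _×_; _,_)
open import Function.Bundles using (_⇔_)

Rel₂ : ∀ {a} (X : Set a) (ℓ : Level) → Set (a ⊔ suc ℓ)
Rel₂ X ℓ = X → X → Set ℓ

Rel₃ : ∀ {a} (X : Set a) (ℓ : Level) → Set (a ⊔ suc ℓ)
Rel₃ X ℓ = X → X → X → Set ℓ

module _ {a ℓ : Level} {X : Set a} where

  E[_] : Rel₃ X ℓ → Rel₂ X (a ⊔ ℓ)
  E[ T ] x y = ∃ λ z → T x y z

  record IsEquivalenceRel {ℓ'} (E : Rel₂ X ℓ') : Set (a ⊔ ℓ') where
    field
      refl  : ∀ x → E x x
      sym   : ∀ {x y} → E x y → E y x
      trans : ∀ {x y z} → E x y → E y z → E x z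

  record IsMS2ICFrame (T : Rel₃ X ℓ) (S : Rel₂ X ℓ) : Set (a ⊔ suc ℓ) where
    field
      T-refl  : ∀ x → T x x x
      T-swap  : ∀ {x y z} → T x y z → T x z y
      E-equiv : IsEquivalenceRel E[ T ]
      T-E     : ∀ {x y z w} → T x y z → E[ T ] x w → T w y z
      T-S     : ∀ {x y z w} → T x y z → S y w → ∃ λ u → T x w u × S z u

  record IsSimpleMS2ICFrame (T : Rel₃ X ℓ) (S : Rel₂ X ℓ) : Set (a ⊔ suc ℓ) where
    field
      frame     : IsMS2ICFrame T S
      inhabited : X
      single    : ∀ x y → E[ T ] x y

  record IsModalContactFrame (R : Rel₂ X ℓ) (S : Rel₂ X ℓ) : Set (a ⊔ ℓ) where
    field
      nonempty : X
      R-refl   : ∀ x → R x x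
      R-sym    : ∀ {x y} → R x y → R y x
      R-S      : ∀ {x y z} → R x y → S x z → ∃ λ w → R z w × S y w

  R[_] : Rel₃ X ℓ → Rel₂ X ℓ
  R[ T ] x y = T x x y

  T[_] : Rel₂ X ℓ → Rel₃ X ℓ
  T[ R ] x y z = R y z

  _≐₂_ : Rel₂ X ℓ → Rel₂ X ℓ → Set (a ⊔ ℓ)
  R ≐₂ R' = ∀ x y → R x y ⇔ R' x y

  _≐₃_ : Rel₃ X ℓ → Rel₃ X ℓ → Set (a ⊔ ℓ)
  T ≐₃ T' = ∀ x y z → T x y z ⇔ T' x y z

SimpleMS2IC : ∀ {a} (X : Set a) (ℓ : Level) → Set (a ⊔ suc ℓ)
SimpleMS2IC X ℓ = Σ (Rel₃ X ℓ) λ T → Σ (Rel₂ X ℓ) λ S → IsSimpleMS2ICFrame T S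

ModalContact : ∀ {a} (X : Set a) (ℓ : Level) → Set (a ⊔ suc ℓ)
ModalContact X ℓ = Σ (Rel₂ X ℓ) λ R → Σ (Rel₂ X ℓ) λ S → IsModalContactFrame R S

-- In an MS²IC-frame, T x y z already makes x and y E_T-related, so T x y z
-- forces T y y z, i.e. y R_T z; simplicity lets the first argument of T move
-- freely, so T x y z holds exactly when y R_T z. Symmetry of R_T and the
-- contact condition for S are the T-swap and T-S axioms read at x = y.
-- Conversely T_R ignores its first argument, so E over T_R is total and the
-- MS²IC axioms reduce to reflexivity, symmetry and the contact condition of R.
module Submission where

open import Defs
open import Level using (Level)
open import Data.Product using (Σ; _×_; _,_; proj₁; proj₂)
open import Relation.Binary.PropositionalEquality using (_≡_; refl)
open import Function.Bundles using (mk⇔)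
open import Function.Construct.Identity using (⇔-id)
open import Function.Construct.Symmetry using (⇔-sym)

module _ {a ℓ : Level} {X : Set a} where

  -- IsEquivalenceRel lives under Defs' anonymous module, whose ℓ it does not use; fix it to ℓ.
  total⇒isEquivalenceRel : {ℓ' : Level} {E : Rel₂ X ℓ'} →
    (∀ x y → E x y) → IsEquivalenceRel {ℓ = ℓ} E
  total⇒isEquivalenceRel total = record
    { refl  = λ x → total x x
    ; sym   = λ {x} {y} _ → total y x
    ; trans = λ {x} {_} {z} _ _ → total x z
    }

  ≐₃-sym : {T T' : Rel₃ X ℓ} → T ≐₃ T' → T' ≐₃ T
  ≐₃-sym T≐T' x y z = ⇔-sym (T≐T' x y z)

  module _ {T : Rel₃ X ℓ} {S : Rel₂ X ℓ} (frame : IsMS2ICFrame T S) where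
    open IsMS2ICFrame frame

    T⇒R[T] : ∀ {x y z} → T x y z → R[ T ] y z
    T⇒R[T] t = T-E t (_ , t)

    R[T]-sym : ∀ {x y} → R[ T ] x y → R[ T ] y x
    R[T]-sym t = T⇒R[T] (T-swap t)

    R[T]-S : ∀ {x y z} → R[ T ] x y → S x z → Σ X λ w → R[ T ] z w × S y w
    R[T]-S t xSz with T-S t xSz
    ... | u , t′ , ySu = u , T⇒R[T] t′ , ySu

    MS2IC⇒modalContact : X → IsModalContactFrame R[ T ] S
    MS2IC⇒modalContact x = record
      { nonempty = x
      ; R-refl   = T-refl
      ; R-sym    = R[T]-sym
      ; R-S      = R[T]-S
      }

  module _ {T : Rel₃ X ℓ} {S : Rel₂ X ℓ} (simple : IsSimpleMS2ICFrame T S) where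
    open IsSimpleMS2ICFrame simple

    simpleMS2IC⇒modalContact : IsModalContactFrame R[ T ] S
    simpleMS2IC⇒modalContact = MS2IC⇒modalContact frame inhabited

    simpleMS2IC⇒T≐T[R[T]] : T ≐₃ T[ R[ T ] ]
    simpleMS2IC⇒T≐T[R[T]] x y z =
      mk⇔ (T⇒R[T] frame) (λ t → IsMS2ICFrame.T-E frame t (single y x))

  module _ {R S : Rel₂ X ℓ} (contact : IsModalContactFrame R S) where
    open IsModalContactFrame contact

    E[T[R]]-total : ∀ x y → E[ T[ R ] ] x y
    E[T[R]]-total x y = y , R-refl y

    modalContact⇒simpleMS2IC : IsSimpleMS2ICFrame T[ R ] S
    modalContact⇒simpleMS2IC = record
      { frame = record
        { T-refl  = R-refl
        ; T-swap  = R-sym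
        ; E-equiv = total⇒isEquivalenceRel E[T[R]]-total
        ; T-E     = λ t _ → t
        ; T-S     = R-S
        }
      ; inhabited = nonempty
      ; single    = E[T[R]]-total
      }

  R≐R[T[R]] : (R : Rel₂ X ℓ) → R ≐₂ R[ T[ R ] ]
  R≐R[T[R]] R x y = ⇔-id (R x y)

  toModalContact : SimpleMS2IC X ℓ → ModalContact X ℓ
  toModalContact (T , S , simple) = R[ T ] , S , simpleMS2IC⇒modalContact simple

  toSimpleMS2IC : ModalContact X ℓ → SimpleMS2IC X ℓ
  toSimpleMS2IC (R , S , contact) = T[ R ] , S , modalContact⇒simpleMS2IC contact

proposition4p6 : ∀ {a ℓ : Level} {X : Set a} →
    ((T : Rel₃ X ℓ) (S : Rel₂ X ℓ) → IsSimpleMS2ICFrame T S →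
    IsModalContactFrame R[ T ] S × (T ≐₃ T[ R[ T ] ]))
    ×
    ((R : Rel₂ X ℓ) (S : Rel₂ X ℓ) → IsModalContactFrame R S →
    IsSimpleMS2ICFrame T[ R ] S × (R ≐₂ R[ T[ R ] ]))
    ×
    (Σ (SimpleMS2IC X ℓ → ModalContact X ℓ) λ F →
    Σ (ModalContact X ℓ → SimpleMS2IC X ℓ) λ G →
    (∀ (f : SimpleMS2IC X ℓ) →
    (proj₁ (F f) ≡ R[ proj₁ f ]) × (proj₁ (proj₂ (F f)) ≡ proj₁ (proj₂ f)))
    ×
    (∀ (m : ModalContact X ℓ) →
    (proj₁ (G m) ≡ T[ proj₁ m ]) × (proj₁ (proj₂ (G m)) ≡ proj₁ (proj₂ m)))
    ×
    (∀ (f : SimpleMS2IC X ℓ) →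
    (proj₁ (G (F f)) ≐₃ proj₁ f) × (proj₁ (proj₂ (G (F f))) ≡ proj₁ (proj₂ f)))
    ×
    (∀ (m : ModalContact X ℓ) →
    (proj₁ (F (G m)) ≐₂ proj₁ m) × (proj₁ (proj₂ (F (G m))) ≡ proj₁ (proj₂ m))))
proposition4p6 =
    (λ T S simple → simpleMS2IC⇒modalContact simple , simpleMS2IC⇒T≐T[R[T]] simple)
  , (λ R S contact → modalContact⇒simpleMS2IC contact , R≐R[T[R]] R)
  , toModalContact
  , toSimpleMS2IC
  , (λ _ → refl , refl)
  , (λ _ → refl , refl)
  , (λ { (T , S , simple) → ≐₃-sym (simpleMS2IC⇒T≐T[R[T]] simple) , refl })
  , (λ { (R , S , _) → R≐R[T[R]] R , refl })
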